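{- Let $n,m\ge0$ be coprime integers, $h=n+m$, and let $Z=\bigoplus_{j\in\mathbb Z}Z^j$ be a graded $1$-truncated Dieudonn\'e module of type $(n,m)$ with $\dim_kZ=h$. Then $C_Z:=\{j\in\mathbb Z: Z^j\ne0\}$ is a beginning of a semi-module of type $(n,m)$.
   Context: $k$ is an algebraically closed field of characteristic $p>0$. A $1$-truncated Dieudonn\'e module is a finite-dimensional $k$-vector space $Z$ with an endomorphism $F$ linear with respect to $a\mapsto a^p$ and an endomorphism $V$ linear with respect to $a\mapsto a^{1/p}$ such that $\ker F=\operatorname{Im}V$ and $\operatorname{Im}F=\ker V$. A graded $1$-truncated Dieudonn\'e module of type $(n,m)$ is one with a $\mathbb Z$-grading $Z=\bigoplus_jZ^j$ such that $F(Z^j)\subseteq Z^{j+n}$ and $V(Z^j)\subseteq Z^{j+m}$. A beginning of a semi-module of type $(n,m)$ is a subset $C\subset\mathbb Z$ such that each residue class $i+(n+m)\mathbb Z$ contains exactly one element of $C$, and for each $i\in C$ either $i+n\in C$ or $i-m\in C$. -}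

module Defs where

open import Level using (Level; _⊔_) renaming (suc to lsuc)
open import Algebra.Bundles using (CommutativeRing)
open import Data.Nat as ℕ using (ℕ; zero; suc)
open import Data.Integer as ℤ using (ℤ; +_)
open import Data.Integer.Divisibility using (_∣_)
open import Data.Fin using (Fin) renaming (zero to fzero; suc to fsuc)
open import Data.Product using (Σ; ∃; _×_; _,_)
open import Data.Sum using (_⊎_)
open import Relation.Nullary using (¬_)
open import Relation.Binary.PropositionalEquality using (_≡_)

record Field (c ℓ : Level) : Set (lsuc (c ⊔ ℓ)) where
  field
    commutativeRing : CommutativeRing c ℓ
  open CommutativeRing commutativeRing public
  field
    0≉1     : ¬ (0# ≈ 1#)
    inverse : ∀ x → ¬ (x ≈ 0#) → ∃ λ y → x * y ≈ 1#

module FieldOps {c ℓ : Level} (K : Field c ℓ) where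
  open Field K

  infixr 8 _^_
  _^_ : Carrier → ℕ → Carrier
  x ^ zero  = 1#
  x ^ suc n = x * (x ^ n)

  ι : ℕ → Carrier
  ι zero    = 0#
  ι (suc n) = 1# + ι n

  lowerTerms : (d : ℕ) → (Fin d → Carrier) → Carrier → Carrier
  lowerTerms zero    cs x = 0#
  lowerTerms (suc d) cs x = cs fzero + x * lowerTerms d (λ i → cs (fsuc i)) x

  monicEval : (d : ℕ) → (Fin d → Carrier) → Carrier → Carrier
  monicEval d cs x = x ^ d + lowerTerms d cs x

  HasCharacteristic : ℕ → Set ℓ
  HasCharacteristic p = ι p ≈ 0#

  AlgebraicallyClosed : Set (c ⊔ ℓ)
  AlgebraicallyClosed =
    ∀ (d : ℕ) → 1 ℕ.≤ d → (cs : Fin d → Carrier) → ∃ λ x → monicEval d cs x ≈ 0#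

  Vect : ℕ → Set c
  Vect h = Fin h → Carrier

  infix 4 _≋_
  _≋_ : ∀ {h} → Vect h → Vect h → Set ℓ
  u ≋ v = ∀ i → u i ≈ v i

  0v : ∀ {h} → Vect h
  0v i = 0#

  infixl 6 _⊕_
  _⊕_ : ∀ {h} → Vect h → Vect h → Vect h
  (u ⊕ v) i = u i + v i

  infixl 7 _·_
  _·_ : ∀ {h} → Carrier → Vect h → Vect h
  (a · v) i = a * v i

-- Z = k^h with a homogeneous basis:
-- the i-th basis vector e_i lies in degree deg i, so
-- Z^j = span{ e_i | deg i = j } and Z = ⊕_j Z^j.
-- F is σ-semilinear, V is σ⁻¹-semilinear: V(a·x) = σ⁻¹(a)·V(x),
-- written equivalently (σ is bijective on a perfect field) as
-- V(a^p · x) = a · V(x).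

record GradedDieudonne {c ℓ : Level} (K : Field c ℓ) (p n m h : ℕ)
       : Set (c ⊔ ℓ) where
  open Field K
  open FieldOps K
  field
    deg : Fin h → ℤ
    F   : Vect h → Vect h
    V   : Vect h → Vect h
    F-cong : ∀ x y → x ≋ y → F x ≋ F y
    V-cong : ∀ x y → x ≋ y → V x ≋ V y
    F-add  : ∀ x y → F (x ⊕ y) ≋ F x ⊕ F y
    V-add  : ∀ x y → V (x ⊕ y) ≋ V x ⊕ V y
    F-semi : ∀ a x → F (a · x) ≋ (a ^ p) · F x
    V-semi : ∀ a x → V ((a ^ p) · x) ≋ a · V x
  InDegree : ℤ → Vect h → Set ℓ
  InDegree j x = ∀ i → ¬ (deg i ≡ j) → x i ≈ 0#
  field
    F-graded : ∀ j x → InDegree j x → InDegree (j ℤ.+ + n) (F x)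
    V-graded : ∀ j x → InDegree j x → InDegree (j ℤ.+ + m) (V x)
    kerF⊆ImV : ∀ x → F x ≋ 0v → ∃ λ y → V y ≋ x
    ImV⊆kerF : ∀ x → (∃ λ y → V y ≋ x) → F x ≋ 0v
    ImF⊆kerV : ∀ x → (∃ λ y → F y ≋ x) → V x ≋ 0v
    kerV⊆ImF : ∀ x → V x ≋ 0v → ∃ λ y → F y ≋ x

  support : ℤ → Set (c ⊔ ℓ)
  support j = ∃ λ x → InDegree j x × ¬ (x ≋ 0v)

record IsBeginning {a : Level} (n m : ℕ) (C : ℤ → Set a) : Set a where
  field
    hits   : ∀ r → ∃ λ i → C i × (+ (n ℕ.+ m) ∣ (i ℤ.- r))
    unique : ∀ i j → C i → C j → + (n ℕ.+ m) ∣ (i ℤ.- j) → i ≡ j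
    step   : ∀ i → C i → C (i ℤ.+ + n) ⊎ C (i ℤ.- + m)

module Submission where

-- A graded 1-truncated Dieudonné module Z of type (n, m) and dimension h = n + m is
-- given by a homogeneous basis e_0, …, e_{h-1} with degrees deg : Fin h → ℤ, so that
-- C_Z = { j | Z^j ≠ 0 } is exactly the set of values of deg (GradedStructure).
--
-- Exactness turns into two step rules for C_Z.  If i ∈ C_Z, i + n ∉ C_Z and e_a has
-- degree i, then F e_a = 0, so e_a = V y; the a-th coordinate of V y only depends on the
-- degree (i − m)-part of y, so i − m ∈ C_Z.  Symmetrically (ker V = im F), i + m ∈ C_Z or
-- i − n ∈ C_Z.  The first rule is the step condition of a beginning.
--
-- Modulo h, i − m ≡ i + n and
-- i + m ≡ i − n, so the two rules say C_Z is closed under ±n up to congruence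
-- (ShiftClosure); since n is invertible modulo h (Bézout), C_Z meets every residue class.
-- As there are only h basis vectors, an injective-hence-surjective choice of
-- representatives shows that no two of them have congruent degrees.
--
-- lemma3p5 combines the two parts; the argument does not use that p is prime, nor the
-- characteristic or algebraic closedness of k.

open import Defs
open import Level using (Level; _⊔_)
open import Data.Nat as ℕ using (ℕ; zero; suc)
import Data.Nat.Properties as ℕ
import Data.Nat.Divisibility as ℕᵈ
open import Data.Nat.Coprimality using (Coprime; coprime-Bézout)
open import Data.Nat.GCD using (module Bézout)
open import Data.Integer using (ℤ)
import Data.Integer.Divisibility as ℤᵘ
open import Data.Fin as Fin using (Fin; toℕ; punchOut)
open import Data.Fin.Properties using (any?; punchOut-injective; <⇒notInjective; toℕ-injective; toℕ<n; toℕ-fromℕ<)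
open import Data.Product as Product using (∃; _×_; _,_; proj₁; proj₂)
open import Data.Sum as Sum using (_⊎_; inj₁; inj₂)
open import Data.Empty using (⊥-elim)
open import Function.Definitions using (Injective)
open import Relation.Nullary using (¬_; Dec; yes; no; contradiction)
open import Relation.Binary.PropositionalEquality using (_≡_; _≢_; refl; sym; trans; cong; subst; subst₂; module ≡-Reasoning)

module Congruence where
  open import Data.Integer using (+_; 0ℤ; 1ℤ; _+_; _-_; _*_; -_; ∣_∣; _⊖_)
  open import Data.Integer.Properties using (+-inverseʳ; pos-*; m-n≡m⊖n; ∣m⊝n∣≤m⊔n; ∣i∣≡0⇒i≡0; i-j≡0⇒i≡j; +-injective)
  open import Data.Integer.Divisibility.Signed using (_∣_; divides; ∣m⇒∣-m; ∣m∣n⇒∣m+n; ∣n⇒∣m*n; ∣⇒∣ᵤ)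
  open import Data.Integer.Tactic.RingSolver using (solve-∀)

  private variable
    h : ℕ
    x y z : ℤ

  infix 4 _≡_[mod_]

  -- Congruence modulo h: h divides the difference.  (A record rather than a
  -- synonym, so that x, y and h can be inferred from a congruence.)
  record _≡_[mod_] (x y : ℤ) (h : ℕ) : Set where
    constructor by-difference
    field divides-difference : + h ∣ x - y

  ≡⇒≡[mod] : x ≡ y → x ≡ y [mod h ]
  ≡⇒≡[mod] {x = x} refl = by-difference (divides 0ℤ (+-inverseʳ x))

  mod-sym : x ≡ y [mod h ] → y ≡ x [mod h ]
  mod-sym {x = x} {y = y} (by-difference h∣x-y) =
    by-difference (subst (_ ∣_) (negate-difference x y) (∣m⇒∣-m h∣x-y))
    where
    negate-difference : ∀ x y → - (x - y) ≡ y - x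
    negate-difference = solve-∀

  mod-trans : x ≡ y [mod h ] → y ≡ z [mod h ] → x ≡ z [mod h ]
  mod-trans {x = x} {y = y} {z = z} (by-difference h∣x-y) (by-difference h∣y-z) =
    by-difference (subst (_ ∣_) (telescope x y z) (∣m∣n⇒∣m+n h∣x-y h∣y-z))
    where
    telescope : ∀ x y z → (x - y) + (y - z) ≡ x - z
    telescope = solve-∀

  mod-+ʳ : ∀ a → x ≡ y [mod h ] → x + a ≡ y + a [mod h ]
  mod-+ʳ {x = x} {y = y} a (by-difference h∣x-y) =
    by-difference (subst (_ ∣_) (translate x y a) h∣x-y)
    where
    translate : ∀ x y a → x - y ≡ (x + a) - (y + a)
    translate = solve-∀

  mod-+ˡ : ∀ a → x ≡ y [mod h ] → a + x ≡ a + y [mod h ]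
  mod-+ˡ {x = x} {y = y} a (by-difference h∣x-y) =
    by-difference (subst (_ ∣_) (translate x y a) h∣x-y)
    where
    translate : ∀ x y a → x - y ≡ (a + x) - (a + y)
    translate = solve-∀

  mod-*ˡ : ∀ a → x ≡ y [mod h ] → a * x ≡ a * y [mod h ]
  mod-*ˡ {x = x} {y = y} a (by-difference h∣x-y) =
    by-difference (subst (_ ∣_) (distribute a x y) (∣n⇒∣m*n a h∣x-y))
    where
    distribute : ∀ a x y → a * (x - y) ≡ a * x - a * y
    distribute = solve-∀

  -- Two naturals below h that are congruent modulo h are equal: their distance is a
  -- multiple of h smaller than h.
  residue-unique : ∀ {r s} → r ℕ.< h → s ℕ.< h → + r ≡ + s [mod h ] → r ≡ s
  residue-unique {h} {r} {s} r<h s<h (by-difference h∣r-s) with ∣ + r - + s ∣ in distance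
  ... | zero  = +-injective (i-j≡0⇒i≡j (+ r) (+ s) (∣i∣≡0⇒i≡0 distance))
  ... | suc d = contradiction (subst (h ℕᵈ.∣_) distance (∣⇒∣ᵤ h∣r-s)) (ℕᵈ.>⇒∤ distance<h)
    where
    open ℕ.≤-Reasoning
    distance<h : suc d ℕ.< h
    distance<h = begin-strict
      suc d         ≡⟨ sym distance ⟩
      ∣ + r - + s ∣ ≡⟨ cong ∣_∣ (m-n≡m⊖n r s) ⟩
      ∣ r ⊖ s ∣     ≤⟨ ∣m⊝n∣≤m⊔n r s ⟩
      r ℕ.⊔ s       <⟨ ℕ.⊔-lub r<h s<h ⟩
      h             ∎

  lift-identity : ∀ a b c d → 1 ℕ.+ a ℕ.* b ≡ c ℕ.* d → 1ℤ + + a * + b ≡ + c * + d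
  lift-identity a b c d eq =
    trans (cong (λ t → 1ℤ + t) (sym (pos-* a b))) (trans (cong +_ eq) (pos-* c d))

  Invertible : ℕ → ℤ → Set
  Invertible h s = ∃ λ u → u * s ≡ 1ℤ [mod h ]

  coprime⇒invertible : ∀ {n m} → Coprime n m → Invertible (n ℕ.+ m) (+ n)
  coprime⇒invertible {n} {m} coprime with coprime-Bézout coprime
  ... | Bézout.+- x y eq = + x + + y , by-difference (divides (+ y) (begin
      (X + Y) * N - 1ℤ         ≡⟨ split X Y N ⟩
      X * N + (Y * N - 1ℤ)     ≡⟨ cong (_+ (Y * N - 1ℤ)) (sym (lift-identity y m x n eq)) ⟩
      1ℤ + Y * M + (Y * N - 1ℤ) ≡⟨ collect Y N M ⟩
      Y * (N + M)              ∎))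
    where
    open ≡-Reasoning
    X = + x ; Y = + y ; N = + n ; M = + m
    split : ∀ X Y N → (X + Y) * N - 1ℤ ≡ X * N + (Y * N - 1ℤ)
    split = solve-∀
    collect : ∀ Y N M → 1ℤ + Y * M + (Y * N - 1ℤ) ≡ Y * (N + M)
    collect = solve-∀
  ... | Bézout.-+ x y eq = - (+ x + + y) , by-difference (divides (- + y) (begin
      - (X + Y) * N - 1ℤ          ≡⟨ split X Y N ⟩
      - (1ℤ + X * N) - Y * N      ≡⟨ cong (λ t → - t - Y * N) (lift-identity x n y m eq) ⟩
      - (Y * M) - Y * N           ≡⟨ collect Y N M ⟩
      - Y * (N + M)               ∎))
    where
    open ≡-Reasoning
    X = + x ; Y = + y ; N = + n ; M = + m
    split : ∀ X Y N → - (X + Y) * N - 1ℤ ≡ - (1ℤ + X * N) - Y * N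
    split = solve-∀
    collect : ∀ Y N M → - (Y * M) - Y * N ≡ - Y * (N + M)
    collect = solve-∀

module ShiftClosure where
  open import Data.Integer using (+_; -[1+_]; 0ℤ; _+_; _-_; _*_; -_)
  open import Data.Integer.Properties using (+-identityʳ; +-assoc; *-assoc; *-identityʳ; suc-*; neg-distribˡ-*; neg-distribʳ-*)
  open import Data.Integer.Tactic.RingSolver using (solve-∀)
  open Congruence

  private variable
    a : Level
    h : ℕ
    s t : ℤ
    D : ℤ → Set a

  ShiftClosed : ℕ → (ℤ → Set a) → ℤ → Set a
  ShiftClosed h D s = ∀ j → D j → ∃ λ j′ → D j′ × j′ ≡ j + s [mod h ]

  shift-zero : ShiftClosed h D 0ℤ
  shift-zero j d = j , d , ≡⇒≡[mod] (sym (+-identityʳ j))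

  shift-+ : ShiftClosed h D s → ShiftClosed h D t → ShiftClosed h D (s + t)
  shift-+ {s = s} {t = t} closed-s closed-t j d with closed-s j d
  ... | j₁ , d₁ , j₁≡j+s with closed-t j₁ d₁
  ... | j₂ , d₂ , j₂≡j₁+t =
    j₂ , d₂ , mod-trans j₂≡j₁+t (mod-trans (mod-+ʳ t j₁≡j+s) (≡⇒≡[mod] (+-assoc j s t)))

  shift-resp : s ≡ t [mod h ] → ShiftClosed h D s → ShiftClosed h D t
  shift-resp s≡t closed j d with closed j d
  ... | j′ , d′ , j′≡j+s = j′ , d′ , mod-trans j′≡j+s (mod-+ˡ j s≡t)

  shift-ℕ-multiple : ShiftClosed h D s → ∀ k → ShiftClosed h D (+ k * s)
  shift-ℕ-multiple closed zero = shift-zero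
  shift-ℕ-multiple {s = s} closed (suc k) =
    subst (ShiftClosed _ _) (sym (suc-* (+ k) s)) (shift-+ closed (shift-ℕ-multiple closed k))

  shift-multiple : ShiftClosed h D s → ShiftClosed h D (- s) → ∀ t → ShiftClosed h D (t * s)
  shift-multiple closed-s closed-−s (+ k) = shift-ℕ-multiple closed-s k
  shift-multiple {s = s} closed-s closed-−s -[1+ k ] =
    subst (ShiftClosed _ _) (trans (sym (neg-distribʳ-* (+ suc k) s)) (neg-distribˡ-* (+ suc k) s))
      (shift-ℕ-multiple closed-−s (suc k))

  -- If s is invertible modulo h, closure under ±s gives closure under every translation t,
  -- since t ≡ (t·u)·s for an inverse u of s.
  shift-any : Invertible h s → ShiftClosed h D s → ShiftClosed h D (- s) → ∀ t → ShiftClosed h D t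
  shift-any {s = s} (u , inverse) closed-s closed-−s t =
    shift-resp t·u·s≡t (shift-multiple closed-s closed-−s (t * u))
    where
    t·u·s≡t : t * u * s ≡ t [mod _ ]
    t·u·s≡t = subst₂ _≡_[mod _ ] (sym (*-assoc t u s)) (*-identityʳ t) (mod-*ˡ t inverse)

  meets-every-residue : (∀ t → ShiftClosed h D t) → ∀ {j₀} → D j₀ → ∀ r → ∃ λ j → D j × j ≡ r [mod h ]
  meets-every-residue closed {j₀} d₀ r with closed (r - j₀) j₀ d₀
  ... | j , d , j≡j₀+[r-j₀] = j , d , mod-trans j≡j₀+[r-j₀] (≡⇒≡[mod] (telescope j₀ r))
    where
    telescope : ∀ j₀ r → j₀ + (r - j₀) ≡ r
    telescope = solve-∀

-- An injective endomap of a finite set is surjective: a missed value would let it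
-- factor injectively through a set with one element fewer.
injective⇒surjective : ∀ {k} (f : Fin k → Fin k) → Injective _≡_ _≡_ f → ∀ b → ∃ λ a → f a ≡ b
injective⇒surjective {suc k} f injective b with any? (λ a → f a Fin.≟ b)
... | yes hit = hit
... | no miss = ⊥-elim (<⇒notInjective (ℕ.n<1+n k) squeezed-injective)
  where
  missed : ∀ a → b ≢ f a
  missed a b≡fa = miss (a , sym b≡fa)
  squeeze : Fin (suc k) → Fin k
  squeeze a = punchOut (missed a)
  squeezed-injective : Injective _≡_ _≡_ squeeze
  squeezed-injective {a} {a′} eq = injective (punchOut-injective (missed a) (missed a′) eq)

Image : ∀ {a b} {A : Set a} {B : Set b} → (A → B) → B → Set (a ⊔ b)
Image f y = ∃ λ x → f x ≡ y

beginning-resp : ∀ {a b n m} {C : ℤ → Set a} {C′ : ℤ → Set b} →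
                 (∀ {j} → C j → C′ j) → (∀ {j} → C′ j → C j) →
                 IsBeginning n m C → IsBeginning n m C′
beginning-resp to from beginning = record
  { hits   = λ r → Product.map₂ (Product.map₁ to) (hits r)
  ; unique = λ i j c c′ → unique i j (from c) (from c′)
  ; step   = λ i c → Sum.map to to (step i (from c))
  }
  where open IsBeginning beginning

module Beginnings where
  open import Data.Integer using (+_; -1ℤ; 1ℤ; _+_; _-_; _*_; -_)
  open import Data.Integer.Divisibility.Signed using (divides; ∣⇒∣ᵤ; ∣ᵤ⇒∣)
  open import Data.Integer.Tactic.RingSolver using (solve-∀)
  open Congruence
  open ShiftClosure

  module _ {h} (f : Fin h → ℤ) (covers : ∀ r → ∃ λ a → f a ≡ r [mod h ]) where

    representative : Fin h → Fin h
    representative ρ = proj₁ (covers (+ toℕ ρ))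

    represents : ∀ ρ → f (representative ρ) ≡ + toℕ ρ [mod h ]
    represents ρ = proj₂ (covers (+ toℕ ρ))

    same-residue : ∀ {ρ ρ′} → f (representative ρ) ≡ f (representative ρ′) [mod h ] → ρ ≡ ρ′
    same-residue {ρ} {ρ′} congruent = toℕ-injective (residue-unique (toℕ<n ρ) (toℕ<n ρ′)
      (mod-trans (mod-sym (represents ρ)) (mod-trans congruent (represents ρ′))))

    representative-injective : Injective _≡_ _≡_ representative
    representative-injective eq = same-residue (≡⇒≡[mod] (cong f eq))

    -- If the h values of f meet every residue class modulo h, they are pairwise incongruent:
    -- every index is a representative, and representatives of one class coincide.
    values-incongruent : ∀ {a b} → f a ≡ f b [mod h ] → a ≡ b
    values-incongruent {a} {b} with injective⇒surjective representative representative-injective a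
                                  | injective⇒surjective representative representative-injective b
    ... | ρ , refl | ρ′ , refl = λ congruent → cong representative (same-residue congruent)

  -- Coprimality rules out n = m = 0, so there is an index.
  coprime⇒index : ∀ {n m} → Coprime n m → Fin (n ℕ.+ m)
  coprime⇒index {suc n} _ = Fin.zero
  coprime⇒index {zero} {suc m} _ = Fin.zero
  coprime⇒index {zero} {zero} coprime = contradiction (coprime (2 ℕᵈ.∣0 , 2 ℕᵈ.∣0)) λ ()

  image-is-beginning : ∀ {n m} → Coprime n m → (f : Fin (n ℕ.+ m) → ℤ) →
    (∀ i → Image f i → Image f (i + + n) ⊎ Image f (i - + m)) →
    (∀ i → Image f i → Image f (i + + m) ⊎ Image f (i - + n)) →
    IsBeginning n m (Image f)
  image-is-beginning {n} {m} coprime f F-rule V-rule =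
    record { hits = hits ; unique = unique ; step = F-rule }
    where
    -- modulo n + m, a step down by m is a step up by n, and a step up by m is a step down by n
    forward : ShiftClosed (n ℕ.+ m) (Image f) (+ n)
    forward i image with F-rule i image
    ... | inj₁ up   = i + + n , up , ≡⇒≡[mod] refl
    ... | inj₂ down = i - + m , down , by-difference (divides -1ℤ (down-is-up i (+ n) (+ m)))
      where
      down-is-up : ∀ i n m → (i - m) - (i + n) ≡ -1ℤ * (n + m)
      down-is-up = solve-∀

    backward : ShiftClosed (n ℕ.+ m) (Image f) (- + n)
    backward i image with V-rule i image
    ... | inj₂ down = i - + n , down , ≡⇒≡[mod] refl
    ... | inj₁ up   = i + + m , up , by-difference (divides 1ℤ (up-is-down i (+ n) (+ m)))
      where
      up-is-down : ∀ i n m → (i + m) - (i - n) ≡ 1ℤ * (n + m)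
      up-is-down = solve-∀

    closed : ∀ t → ShiftClosed (n ℕ.+ m) (Image f) t
    closed = shift-any (coprime⇒invertible coprime) forward backward

    covers : ∀ r → ∃ λ a → f a ≡ r [mod n ℕ.+ m ]
    covers r = index (meets-every-residue closed (coprime⇒index coprime , refl) r)
      where
      index : (∃ λ j → Image f j × j ≡ r [mod n ℕ.+ m ]) → ∃ λ a → f a ≡ r [mod n ℕ.+ m ]
      index (_ , (a , refl) , fa≡r) = a , fa≡r

    hits : ∀ r → ∃ λ i → Image f i × + (n ℕ.+ m) ℤᵘ.∣ (i - r)
    hits r = let (a , by-difference divisible) = covers r in f a , (a , refl) , ∣⇒∣ᵤ divisible

    unique : ∀ i j → Image f i → Image f j → + (n ℕ.+ m) ℤᵘ.∣ (i - j) → i ≡ j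
    unique _ _ (a , refl) (b , refl) divisible =
      cong f (values-incongruent f covers (by-difference (∣ᵤ⇒∣ divisible)))

module Coordinates {c ℓ : Level} (K : Field c ℓ) {h : ℕ} where
  open Field K using (_≈_; 0#; 1#; +-cong; +-identityˡ; +-identityʳ; 0≉1)
    renaming (refl to ≈-refl; sym to ≈-sym; trans to ≈-trans)
  open FieldOps K using (Vect; _≋_; 0v; _⊕_)

  SupportedAt : Fin h → Vect h → Set ℓ
  SupportedAt b y = ∀ c → c ≢ b → y c ≈ 0#

  basis : Fin h → Vect h
  basis b c with c Fin.≟ b
  ... | yes _ = 1#
  ... | no _  = 0#

  basis-supported : ∀ b → SupportedAt b (basis b)
  basis-supported b c c≢b with c Fin.≟ b
  ... | yes c≡b = contradiction c≡b c≢b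
  ... | no _    = ≈-refl

  basis-self : ∀ b → basis b b ≈ 1#
  basis-self b with b Fin.≟ b
  ... | yes _   = ≈-refl
  ... | no b≢b = contradiction refl b≢b

  basis-nonzero : ∀ b → ¬ (basis b ≋ 0v)
  basis-nonzero b basis≋0 = 0≉1 (≈-trans (≈-sym (basis≋0 b)) (basis-self b))

  keep : ℕ → Vect h → Vect h
  keep k y c with toℕ c ℕ.≟ k
  ... | yes _ = y c
  ... | no _  = 0#

  keep-on : ∀ {k} y c → toℕ c ≡ k → keep k y c ≈ y c
  keep-on {k} y c c≡k with toℕ c ℕ.≟ k
  ... | yes _   = ≈-refl
  ... | no c≢k = contradiction c≡k c≢k

  keep-off : ∀ {k} y c → toℕ c ≢ k → keep k y c ≈ 0#
  keep-off {k} y c c≢k with toℕ c ℕ.≟ k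
  ... | yes c≡k = contradiction c≡k c≢k
  ... | no _    = ≈-refl

  keep-supported : ∀ {k} (k<h : k ℕ.< h) y → SupportedAt (Fin.fromℕ< k<h) (keep k y)
  keep-supported k<h y c c≢k = keep-off y c λ c≡k →
    c≢k (toℕ-injective (trans c≡k (sym (toℕ-fromℕ< k<h))))

  prefix : ℕ → Vect h → Vect h
  prefix zero    y = 0v
  prefix (suc k) y = prefix k y ⊕ keep k y

  prefix-beyond : ∀ k y c → k ℕ.≤ toℕ c → prefix k y c ≈ 0#
  prefix-beyond zero    y c _   = ≈-refl
  prefix-beyond (suc k) y c k<c = ≈-trans
    (+-cong (prefix-beyond k y c (ℕ.<⇒≤ k<c)) (keep-off y c (ℕ.>⇒≢ k<c)))
    (+-identityˡ 0#)

  prefix-within : ∀ k y c → toℕ c ℕ.< k → prefix k y c ≈ y c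
  prefix-within (suc k) y c c<1+k with ℕ.m<1+n⇒m<n∨m≡n c<1+k
  ... | inj₁ c<k = ≈-trans (+-cong (prefix-within k y c c<k) (keep-off y c (ℕ.<⇒≢ c<k))) (+-identityʳ (y c))
  ... | inj₂ c≡k = ≈-trans (+-cong (prefix-beyond k y c (ℕ.≤-reflexive (sym c≡k))) (keep-on y c c≡k))
                           (+-identityˡ (y c))

  -- Induction over coordinates: a property of vectors that respects ≋, holds for 0,
  -- is closed under sums and holds for vectors supported at one coordinate holds for
  -- every vector, since y is the sum of its h coordinate parts.
  coordinate-induction : ∀ {q} (Q : Vect h → Set q) → (∀ {u v} → u ≋ v → Q u → Q v) → Q 0v →
                         (∀ {u v} → Q u → Q v → Q (u ⊕ v)) → (∀ b y → SupportedAt b y → Q y) →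
                         ∀ y → Q y
  coordinate-induction Q resp zero-case sum-case single-case y =
    resp (λ c → prefix-within h y c (toℕ<n c)) (prefixes h ℕ.≤-refl)
    where
    prefixes : ∀ k → k ℕ.≤ h → Q (prefix k y)
    prefixes zero    _   = zero-case
    prefixes (suc k) k<h = sum-case (prefixes k (ℕ.<⇒≤ k<h)) (single-case _ _ (keep-supported k<h y))

module GradedStructure {c ℓ : Level} {K : Field c ℓ} {p n m h : ℕ} (Z : GradedDieudonne K p n m h) where
  open import Data.Integer using (+_; _+_; _-_)
  import Data.Integer.Properties as ℤ
  open import Data.Integer.Tactic.RingSolver using (solve-∀)
  open Field K using (_≈_; 0#; 1#; +-cong; +-identityˡ; 0≉1)
    renaming (refl to ≈-refl; sym to ≈-sym; trans to ≈-trans)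
  open FieldOps K using (Vect; _≋_; 0v; _⊕_)
  open GradedDieudonne Z
  open Coordinates K

  supported⇒homogeneous : ∀ {b y} → SupportedAt b y → InDegree (deg b) y
  supported⇒homogeneous supported i deg-i≢deg-b = supported i λ i≡b → deg-i≢deg-b (cong deg i≡b)

  empty-degree : ∀ {j x} → ¬ Image deg j → InDegree j x → x ≋ 0v
  empty-degree no-basis homogeneous i = homogeneous i λ deg-i≡j → no-basis (i , deg-i≡j)

  image? : ∀ j → Dec (Image deg j)
  image? j = any? λ a → deg a ℤ.≟ j

  image⇒support : ∀ {j} → Image deg j → support j
  image⇒support (b , refl) = basis b , supported⇒homogeneous (basis-supported b) , basis-nonzero b

  support⇒image : ∀ {j} → support j → Image deg j
  support⇒image {j} (x , homogeneous , nonzero) with image? j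
  ... | yes image = image
  ... | no  empty = contradiction (empty-degree empty homogeneous) nonzero

  record GradedMap (s : ℕ) (G : Vect h → Vect h) : Set (c ⊔ ℓ) where
    field
      resp     : ∀ {x y} → x ≋ y → G x ≋ G y
      additive : ∀ x y → G (x ⊕ y) ≋ G x ⊕ G y
      graded   : ∀ j x → InDegree j x → InDegree (j + + s) (G x)

  F-graded-map : GradedMap n F
  F-graded-map = record { resp = F-cong _ _ ; additive = F-add ; graded = F-graded }

  V-graded-map : GradedMap m V
  V-graded-map = record { resp = V-cong _ _ ; additive = V-add ; graded = V-graded }

  -- The a-th coordinate of G y only depends on the component of y in degree deg a − s,
  -- so it vanishes when Z^(deg a − s) = 0.
  coordinate-vanishes : ∀ {s G} → GradedMap s G → ∀ a → ¬ Image deg (deg a - + s) → ∀ y → G y a ≈ 0#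
  coordinate-vanishes {s} {G} G-map a empty =
    coordinate-induction (λ y → G y a ≈ 0#)
      (λ u≋v Gua≈0 → ≈-trans (≈-sym (resp u≋v a)) Gua≈0)
      (single-case a 0v λ _ _ → ≈-refl)
      (λ {u} {v} Gua≈0 Gva≈0 → ≈-trans (additive u v a) (≈-trans (+-cong Gua≈0 Gva≈0) (+-identityˡ 0#)))
      single-case
    where
    open GradedMap G-map
    undo-shift : ∀ x s → x ≡ (x + s) - s
    undo-shift = solve-∀
    single-case : ∀ b y → SupportedAt b y → G y a ≈ 0#
    single-case b y supported = graded (deg b) y (supported⇒homogeneous supported) a λ deg-a≡deg-b+s →
      empty (b , trans (undo-shift (deg b) (+ s)) (cong (_- + s) (sym deg-a≡deg-b+s)))

  -- Exactness step: if ker G ⊆ im G′ and Z^(i+s) = 0 for a degree i ∈ C_Z, a basis vector of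
  -- degree i lies in ker G = im G′, and its preimage forces Z^(i−t) ≠ 0.
  exactness-step : ∀ {s t G G′} → GradedMap s G → GradedMap t G′ → (∀ x → G x ≋ 0v → ∃ λ y → G′ y ≋ x) →
                   ∀ i → Image deg i → Image deg (i + + s) ⊎ Image deg (i - + t)
  exactness-step {s} {t} {G} {G′} G-map G′-map ker⊆im _ (a , refl)
    with image? (deg a + + s) | image? (deg a - + t)
  ... | yes up    | _          = inj₁ up
  ... | no _      | yes down   = inj₂ down
  ... | no no-up  | no no-down = contradiction 0≈1 0≉1
    where
    Ge≋0 : G (basis a) ≋ 0v
    Ge≋0 = empty-degree no-up
      (GradedMap.graded G-map (deg a) (basis a) (supported⇒homogeneous (basis-supported a)))
    preimage : ∃ λ y → G′ y ≋ basis a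
    preimage = ker⊆im (basis a) Ge≋0
    0≈1 : 0# ≈ 1#
    0≈1 = ≈-trans (≈-sym (coordinate-vanishes G′-map a no-down (proj₁ preimage)))
                  (≈-trans (proj₂ preimage a) (basis-self a))

  F-rule : ∀ i → Image deg i → Image deg (i + + n) ⊎ Image deg (i - + m)
  F-rule = exactness-step F-graded-map V-graded-map kerF⊆ImV

  V-rule : ∀ i → Image deg i → Image deg (i + + m) ⊎ Image deg (i - + n)
  V-rule = exactness-step V-graded-map F-graded-map kerV⊆ImF

-- Natural-number addition, as in the statement; brought into scope only here because
-- the modules above use integer addition under the same name.
open import Data.Nat using (_+_)
open import Data.Nat.Primality using (Prime)

lemma3p5 : {c ℓ : Level} (K : Field c ℓ) (p : ℕ) → Prime p →
           FieldOps.HasCharacteristic K p → FieldOps.AlgebraicallyClosed K →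
           (n m : ℕ) → Coprime n m →
           (Z : GradedDieudonne K p n m (n + m)) →
           IsBeginning n m (GradedDieudonne.support Z)
lemma3p5 K p _ _ _ n m coprime Z =
  beginning-resp image⇒support support⇒image
    (Beginnings.image-is-beginning coprime deg F-rule V-rule)
  where
  open GradedDieudonne Z using (deg)
  open GradedStructure Z using (image⇒support; support⇒image; F-rule; V-rule)
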